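{- Let $(W,S)$ be a simply-laced triangle-free Coxeter system and let ${\boldsymbol{\alpha}}$ be a link of rank $r\ge2$. Then for each $1\le i\le r-1$, $|\operatorname{supp}_{\llbracket 2i\rrbracket}([{\boldsymbol{\alpha}}])\cap\operatorname{supp}_{\llbracket 2i+2\rrbracket}([{\boldsymbol{\alpha}}])|=1$.
   Context: A Coxeter system $(W,S)$: finite $S$, $W=\langle S\mid (st)^{m(s,t)}=e\rangle$, $m(s,s)=1$, $m(s,t)\in\{2,3,\dots,\infty\}$ for $s\ne t$; simply laced: $m(s,t)\le3$; Coxeter graph $\Gamma$ on $S$ with edge $\{s,t\}$ iff $m(s,t)\ge3$; triangle free: no three-cycles in $\Gamma$. Reduced expression: minimal-length word for its element. Braid move: replace consecutive $sts$ by $tst$ with $m(s,t)=3$; braid class $[{\boldsymbol{\alpha}}]$: reduced expressions reachable from ${\boldsymbol{\alpha}}$ by braid moves. For ${\boldsymbol{\alpha}}=s_{x_1}\cdots s_{x_m}$, $\operatorname{supp}_{\llbracket k\rrbracket}({\boldsymbol{\alpha}})=\{s_{x_k}\}$ and $\operatorname{supp}_{\llbracket k\rrbracket}([{\boldsymbol{\alpha}}])=\bigcup_{{\boldsymbol{\beta}}\in[{\boldsymbol{\alpha}}]}\operatorname{supp}_{\llbracket k\rrbracket}({\boldsymbol{\beta}})$ (the set of letters occurring in position $k$ across the braid class). $\llbracket i,i+2\rrbracket$ is a braid shadow of ${\boldsymbol{\alpha}}$ if $s_{x_i}=s_{x_{i+2}}$ and $m(s_{x_i},s_{x_{i+1}})=3$;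 $\operatorname{bs}([{\boldsymbol{\alpha}}])$ is the set of braid shadows of all elements of $[{\boldsymbol{\alpha}}]$, $\operatorname{rank}({\boldsymbol{\alpha}})=|\operatorname{bs}([{\boldsymbol{\alpha}}])|$. A reduced expression with $m\ge1$ letters is a link if $m=1$ or $m$ is odd and $\operatorname{bs}([{\boldsymbol{\alpha}}])=\{\llbracket1,3\rrbracket,\dots,\llbracket m-2,m\rrbracket\}$; a link of rank $r$ has $2r+1$ letters. -}

module Defs where

open import Data.Nat using (ℕ; zero; suc; _+_; _*_; _∸_; _≤_)
open import Data.Fin using (Fin)
open import Data.List using (List; []; _∷_; _++_; length)
open import Data.List.Membership.Propositional using (_∈_)
open import Data.List.Relation.Unary.Unique.Propositional using (Unique)
open import Data.Maybe using (Maybe; just; nothing)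
open import Data.Product using (Σ; ∃; ∃-syntax; _×_; _,_)
open import Data.Sum using (_⊎_)
open import Data.Empty using (⊥)
open import Relation.Nullary using (¬_)
open import Relation.Binary.PropositionalEquality using (_≡_; _≢_)
open import Relation.Binary.Construct.Closure.ReflexiveTransitive using (Star)
open import Relation.Binary.Construct.Closure.Equivalence using (EqClosure)

data ℕ∞ : Set where
  fin : ℕ → ℕ∞
  ∞   : ℕ∞

data _≥∞_ : ℕ∞ → ℕ → Set where
  fin≥ : ∀ {m k} → k ≤ m → fin m ≥∞ k
  ∞≥   : ∀ {k} → ∞ ≥∞ k

record CoxeterSystem (n : ℕ) : Set where
  field
    m        : Fin n → Fin n → ℕ∞
    m-diag   : ∀ s → m s s ≡ fin 1
    m-sym    : ∀ s t → m s t ≡ m t s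
    m-offdiag : ∀ s t → s ≢ t → m s t ≥∞ 2

module _ {n : ℕ} (C : CoxeterSystem n) where
  open CoxeterSystem C

  Word : Set
  Word = List (Fin n)

  pow : Word → ℕ → Word
  pow w zero    = []
  pow w (suc k) = w ++ pow w k

  data RelStep : Word → Word → Set where
    rel : ∀ u v s t k → m s t ≡ fin k →
          RelStep (u ++ pow (s ∷ t ∷ []) k ++ v) (u ++ v)

  _≈W_ : Word → Word → Set
  _≈W_ = EqClosure RelStep

  Reduced : Word → Set
  Reduced α = ∀ β → α ≈W β → length α ≤ length β

  data BraidMove : Word → Word → Set where
    braid : ∀ u v s t → m s t ≡ fin 3 →
            BraidMove (u ++ s ∷ t ∷ s ∷ v) (u ++ t ∷ s ∷ t ∷ v)

  InBraidClass : Word → Word → Set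
  InBraidClass α β = Star BraidMove α β

  -- letter in position k (1-indexed)
  at : Word → ℕ → Maybe (Fin n)
  at []      _             = nothing
  at (x ∷ w) zero          = nothing
  at (x ∷ w) (suc zero)    = just x
  at (x ∷ w) (suc (suc k)) = at w (suc k)

  InSupp : Word → ℕ → Fin n → Set
  InSupp α k s = ∃[ β ] (InBraidClass α β × at β k ≡ just s)

  IsBraidShadow : Word → ℕ → Set
  IsBraidShadow β i = ∃[ s ] ∃[ t ]
    (at β i ≡ just s × at β (i + 2) ≡ just s × at β (i + 1) ≡ just t × m s t ≡ fin 3)

  InBS : Word → ℕ → Set
  InBS α i = ∃[ β ] (InBraidClass α β × IsBraidShadow β i)

  -- rank(α) = |bs([α])| = r : some duplicate-free list of size r enumerates bs([α])
  HasRank : Word → ℕ → Set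
  HasRank α r = ∃[ l ] (Unique l × length l ≡ r ×
                 (∀ i → (i ∈ l → InBS α i) × (InBS α i → i ∈ l)))

  Odd : ℕ → Set
  Odd k = ∃[ j ] (k ≡ 1 + 2 * j)

  IsLink : Word → Set
  IsLink α = Reduced α × 1 ≤ length α ×
    (length α ≡ 1 ⊎
     (Odd (length α) ×
      (∀ i → (InBS α i → Odd i × i + 2 ≤ length α)
           × (Odd i × i + 2 ≤ length α → InBS α i))))

SimplyLaced : ∀ {n} → CoxeterSystem n → Set
SimplyLaced {n} C = ∀ s t → ∃[ k ] (CoxeterSystem.m C s t ≡ fin k × k ≤ 3)

Edge : ∀ {n} → CoxeterSystem n → Fin n → Fin n → Set
Edge C s t = s ≢ t × CoxeterSystem.m C s t ≥∞ 3

TriangleFree : ∀ {n} → CoxeterSystem n → Set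
TriangleFree {n} C = ∀ (s t u : Fin n) →
  ¬ (Edge C s t × Edge C t u × Edge C u s)

{-# OPTIONS --safe #-}
module Submission where

-- In a link every braid shadow starts at an odd position, so every braid move applied within [α]
-- acts on positions 2j + 1, 2j + 2, 2j + 3. Seen through a window q, …, q + 4 with q even, such a
-- move leaves the window alone, braids its three middle letters, or swaps one of its outer pairs.
-- Triangle-freeness then shows that the letters occurring at the centre 2 + q across [α] are
-- exactly the two letters x, a of a braid shadow x a x at 1 + q; likewise {y, b} at 4 + q.
-- The pairs meet: the letter at 3 + q stays in {x, a} until a braid move also puts it in {y, b}.
-- They are not equal: otherwise the letter at 4 + q would be x or a, producing a braid shadow at
-- the even position 2 + q. Finally, counting odd positions bounds the rank by half the length, so
-- the shadows at 2i − 1 and 2i + 1 exist whenever i ≤ r − 1.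

open import Defs
open import Data.Nat using (ℕ; zero; suc; _+_; _*_; _∸_; _≤_; _<_; _≟_; z≤n; s≤s; s≤s⁻¹)
open import Data.Nat.Properties
  using ( suc-injective; +-comm; +-suc; *-suc; ≤-refl; ≤-trans; <⇒≤; m≤m+n; m≤n+m; +-mono-≤
        ; *-monoʳ-≤; *-cancelˡ-≤; even≢odd)
open import Data.Nat.Tactic.RingSolver using (solve-∀)
open import Data.Fin using (Fin)
open import Data.List using (List; []; _∷_; _++_; length; applyUpTo)
open import Data.List.Properties using (length-++; length-removeAt′; length-applyUpTo)
open import Data.List.Membership.Propositional using (_∈_)
open import Data.List.Membership.Propositional.Properties using (∈-applyUpTo⁺)
open import Data.List.Relation.Binary.Subset.Propositional using (_⊆_)
open import Data.List.Relation.Unary.Any using (here; there; _─_)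
open import Data.List.Relation.Unary.All using (lookup)
open import Data.List.Relation.Unary.AllPairs using (_∷_)
open import Data.List.Relation.Unary.Unique.Propositional using (Unique)
open import Data.Maybe using (Maybe; just; nothing)
open import Data.Product using (∃₂; ∃-syntax; _×_; _,_; proj₁; proj₂; map₂)
open import Data.Sum using (_⊎_; inj₁; inj₂)
open import Data.Empty using (⊥; ⊥-elim)
open import Function using (id; _∘_; _⇔_; mk⇔; Equivalence)
open import Relation.Nullary using (¬_; Dec; yes; no)
open import Relation.Binary.PropositionalEquality
  using (_≡_; _≢_; refl; sym; trans; cong; subst; subst₂; ≢-sym; module ≡-Reasoning)
open import Relation.Binary.Construct.Closure.ReflexiveTransitive using (Star; ε; _◅_; _◅◅_; reverse)

module _ {a} {A : Set a} where

  ∈-─⁺ : ∀ {xs : List A} {x y} (x∈xs : x ∈ xs) → y ∈ xs → y ≢ x → y ∈ (xs ─ x∈xs)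
  ∈-─⁺ (here refl) (here refl) y≢x = ⊥-elim (y≢x refl)
  ∈-─⁺ (here refl) (there y∈xs) _ = y∈xs
  ∈-─⁺ (there x∈xs) (here refl) _ = here refl
  ∈-─⁺ (there x∈xs) (there y∈xs) y≢x = there (∈-─⁺ x∈xs y∈xs y≢x)

  Unique∧⊆⇒length≤ : ∀ {xs ys : List A} → Unique xs → xs ⊆ ys → length xs ≤ length ys
  Unique∧⊆⇒length≤ {[]} _ _ = z≤n
  Unique∧⊆⇒length≤ {x ∷ xs} {ys} (x∉xs ∷ xs!) xs⊆ys =
    subst (suc (length xs) ≤_) (sym (length-removeAt′ ys _))
      (s≤s (Unique∧⊆⇒length≤ xs! λ y∈xs →
        ∈-─⁺ x∈ys (xs⊆ys (there y∈xs)) (≢-sym (lookup x∉xs y∈xs))))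
    where
    x∈ys : x ∈ ys
    x∈ys = xs⊆ys (here refl)

  ∈-pair-exhausted : ∀ {x z p a b : A} → x ≢ z →
    x ∈ a ∷ b ∷ [] → z ∈ a ∷ b ∷ [] → p ∈ a ∷ b ∷ [] → p ≡ x ⊎ p ≡ z
  ∈-pair-exhausted x≢z (here refl) (here refl) _ = ⊥-elim (x≢z refl)
  ∈-pair-exhausted x≢z (there (here refl)) (there (here refl)) _ = ⊥-elim (x≢z refl)
  ∈-pair-exhausted _ (here refl) (there (here refl)) (here refl) = inj₁ refl
  ∈-pair-exhausted _ (here refl) (there (here refl)) (there (here refl)) = inj₂ refl
  ∈-pair-exhausted _ (there (here refl)) (here refl) (here refl) = inj₂ refl
  ∈-pair-exhausted _ (there (here refl)) (here refl) (there (here refl)) = inj₁ refl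
  ∈-pair-exhausted _ (there (there ())) _ _
  ∈-pair-exhausted _ _ (there (there ())) _
  ∈-pair-exhausted _ _ _ (there (there ()))

  ∈-pair-unique : ∀ {x z s t : A} {P : A → Set} → (P x → P z → ⊥) →
    s ∈ x ∷ z ∷ [] → P s → t ∈ x ∷ z ∷ [] → P t → t ≡ s
  ∈-pair-unique _ (here refl) _ (here refl) _ = refl
  ∈-pair-unique _ (there (here refl)) _ (there (here refl)) _ = refl
  ∈-pair-unique ¬both (here refl) px (there (here refl)) pz = ⊥-elim (¬both px pz)
  ∈-pair-unique ¬both (there (here refl)) pz (here refl) px = ⊥-elim (¬both px pz)
  ∈-pair-unique _ (there (there ())) _ _ _
  ∈-pair-unique _ _ _ (there (there ())) _

data Even : ℕ → Set where
  zero : Even 0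
  2+_  : ∀ {m} → Even m → Even (2 + m)

even-double : ∀ j → Even (2 * j)
even-double zero    = zero
even-double (suc j) = subst Even (sym (*-suc 2 j)) (2+ even-double j)

even⇒double : ∀ {m} → Even m → ∃[ j ] (m ≡ 2 * j)
even⇒double zero = 0 , refl
even⇒double (2+ e) with j , refl ← even⇒double e = suc j , sym (*-suc 2 j)

-- Proximity q m: where a braid move on positions m + 1, m + 2, m + 3 lies relative to the window
-- q, …, q + 4; for even q and m these five cases are exhaustive.
data Proximity : ℕ → ℕ → Set where
  farBefore : ∀ {m} c → Proximity (m + (4 + c)) m
  before    : ∀ {m} → Proximity (m + 2) m
  aligned   : ∀ {m} → Proximity m m
  after     : ∀ {q} → Proximity q (2 + q)
  farAfter  : ∀ {q} c → Proximity q (4 + (q + c))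

proximity : ∀ {q m} → Even q → Even m → Proximity q m
proximity zero zero = aligned
proximity zero (2+ zero) = after
proximity zero (2+ 2+_ {m} _) = farAfter m
proximity (2+ zero) zero = before
proximity (2+ 2+_ {q} _) zero = farBefore q
proximity (2+ eq) (2+ em) with proximity eq em
... | farBefore c = farBefore c
... | before      = before
... | aligned     = aligned
... | after       = after
... | farAfter c  = farAfter c

odd-fits : ∀ {j k} → (1 + 2 * j) + 2 ≤ 1 + 2 * k ⇔ j < k
odd-fits {j} {k} = mk⇔
  (λ fits → *-cancelˡ-≤ 2 (s≤s⁻¹ (subst (_≤ 1 + 2 * k) (next-odd j) fits)))
  (λ j<k → subst (_≤ 1 + 2 * k) (sym (next-odd j)) (s≤s (*-monoʳ-≤ 2 j<k)))
  where
  next-odd : ∀ j → (1 + 2 * j) + 2 ≡ 1 + 2 * suc j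
  next-odd = solve-∀

module _ {n : ℕ} (C : CoxeterSystem n) where
  open CoxeterSystem C

  Adjacent : Fin n → Fin n → Set
  Adjacent s t = m s t ≡ fin 3

  adjacent-sym : ∀ {s t} → Adjacent s t → Adjacent t s
  adjacent-sym {s} {t} st = trans (m-sym t s) st

  adjacent⇒≢ : ∀ {s t} → Adjacent s t → s ≢ t
  adjacent⇒≢ {s} st refl with () ← trans (sym (m-diag s)) st

  adjacent? : ∀ s t → Dec (Adjacent s t)
  adjacent? s t with m s t
  ... | ∞ = no λ ()
  ... | fin k with k ≟ 3
  ...   | yes refl = yes refl
  ...   | no k≢3 = no λ { refl → k≢3 refl }

  triangle-free : TriangleFree C → ∀ {s t u} → Adjacent s t → Adjacent t u → Adjacent u s → ⊥
  triangle-free TF {s} {t} {u} st tu us = TF s t u (edge st , edge tu , edge us)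
    where
    edge : ∀ {x y} → Adjacent x y → Edge C x y
    edge xy = adjacent⇒≢ xy , subst (_≥∞ 3) (sym xy) (fin≥ ≤-refl)

  at-++ : ∀ (u x : Word C) k → at C (u ++ x) (suc (length u + k)) ≡ at C x (suc k)
  at-++ []      x k = refl
  at-++ (_ ∷ u) x k = at-++ u x k

  at-++-after : ∀ (u x : Word C) {m} k → length u ≡ m → at C (u ++ x) (suc k + m) ≡ at C x (suc k)
  at-++-after u x k refl rewrite +-comm k (length u) = at-++ u x k

  at-zero : ∀ w → at C w 0 ≡ nothing
  at-zero []      = refl
  at-zero (_ ∷ _) = refl

  at-++-before : ∀ (u x y : Word C) {m p} → p ≤ m → length u ≡ m →
    at C (u ++ x) p ≡ at C (u ++ y) p
  at-++-before u x y {p = zero} _ _ = trans (at-zero (u ++ x)) (sym (at-zero (u ++ y)))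
  at-++-before (_ ∷ u) x y {p = suc zero} _ _ = refl
  at-++-before (_ ∷ u) x y {p = suc (suc p)} (s≤s p<m) refl = at-++-before u x y p<m refl
  at-++-before [] x y {p = suc _} () refl

  -- IsBraidShadow with the offsets on the left (1 + p, 2 + p), so that they compute.
  record Shadow (w : Word C) (p : ℕ) (s t : Fin n) : Set where
    constructor shadow
    field
      first    : at C w p ≡ just s
      middle   : at C w (1 + p) ≡ just t
      last     : at C w (2 + p) ≡ just s
      adjacent : Adjacent s t

  shadow⇒isBraidShadow : ∀ {w p s t} → Shadow w p s t → IsBraidShadow C w p
  shadow⇒isBraidShadow {w} {p} {s} {t} (shadow hs ht hs′ st) =
    s , t , hs , subst (λ k → at C w k ≡ just s) (+-comm 2 p) hs′ ,
    subst (λ k → at C w k ≡ just t) (+-comm 1 p) ht , st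

  isBraidShadow⇒shadow : ∀ {w p} → IsBraidShadow C w p → ∃₂ (Shadow w p)
  isBraidShadow⇒shadow {w} {p} (s , t , hs , hs′ , ht , st) =
    s , t , shadow hs (subst (λ k → at C w k ≡ just t) (+-comm p 1) ht)
                      (subst (λ k → at C w k ≡ just s) (+-comm p 2) hs′) st

  braidMove-shadow : ∀ u v {s t} → Adjacent s t → Shadow (u ++ s ∷ t ∷ s ∷ v) (suc (length u)) s t
  braidMove-shadow u v st =
    shadow (at-++-after u _ 0 refl) (at-++-after u _ 1 refl) (at-++-after u _ 2 refl) st

  shadow-next : ∀ {w p s t} → Shadow w p s t → at C w (3 + p) ≡ just t → Shadow w (1 + p) t s
  shadow-next (shadow _ ht hs st) ht′ = shadow ht hs ht′ (adjacent-sym st)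

  split-at : ∀ w p {x y z} →
    at C w (1 + p) ≡ just x → at C w (2 + p) ≡ just y → at C w (3 + p) ≡ just z →
    ∃₂ λ u v → w ≡ u ++ x ∷ y ∷ z ∷ v × length u ≡ p
  split-at (_ ∷ _ ∷ _ ∷ v) zero refl refl refl = [] , v , refl , refl
  split-at (a ∷ w) (suc p) hx hy hz with u , v , refl , refl ← split-at w p hx hy hz =
    a ∷ u , v , refl , refl
  split-at (_ ∷ []) zero _ () _
  split-at (_ ∷ _ ∷ []) zero _ _ ()

  braid-shadow : ∀ {w p x z} → Shadow w (suc p) x z →
    ∃[ w′ ] (BraidMove C w w′ × Shadow w′ (suc p) z x × at C w′ (4 + p) ≡ at C w (4 + p))
  braid-shadow {w} {p} (shadow hx hz hx′ xz) with u , v , refl , refl ← split-at w p hx hz hx′ =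
    u ++ _ ∷ _ ∷ _ ∷ v , braid u v _ _ xz , braidMove-shadow u v (adjacent-sym xz) ,
    trans (at-++-after u _ 3 refl) (sym (at-++-after u _ 3 refl))

  record Side : Set where
    constructor side
    field near far : Maybe (Fin n)

  record Window : Set where
    constructor window
    field left : Side; centre : Maybe (Fin n); right : Side
  open Window

  windowAt : Word C → ℕ → Window
  windowAt w q =
    window (side (at C w (1 + q)) (at C w q)) (at C w (2 + q)) (side (at C w (3 + q)) (at C w (4 + q)))

  windowAt-≡ : ∀ w w′ q q′ → (∀ j → j ≤ 4 → at C w (j + q) ≡ at C w′ (j + q′)) →
    windowAt w q ≡ windowAt w′ q′
  windowAt-≡ _ _ _ _ agree
    rewrite agree 0 z≤n | agree 1 (s≤s z≤n) | agree 2 (s≤s (s≤s z≤n))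
          | agree 3 (s≤s (s≤s (s≤s z≤n))) | agree 4 (s≤s (s≤s (s≤s (s≤s z≤n)))) = refl

  windowAt-++ : ∀ (u x : Word C) {m} k → length u ≡ m →
    windowAt (u ++ x) (m + suc k) ≡ windowAt x (suc k)
  windowAt-++ u x {m} k refl = windowAt-≡ (u ++ x) x (m + suc k) (suc k) λ j _ → begin
    at C (u ++ x) (j + (m + suc k))  ≡⟨ cong (at C (u ++ x)) (reassoc j m k) ⟩
    at C (u ++ x) (suc (m + (j + k))) ≡⟨ at-++ u x (j + k) ⟩
    at C x (suc (j + k))              ≡⟨ cong (at C x) (sym (+-suc j k)) ⟩
    at C x (j + suc k)                ∎
    where
    open ≡-Reasoning
    reassoc : ∀ j m k → j + (m + suc k) ≡ suc (m + (j + k))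
    reassoc = solve-∀

  data WindowMove : Window → Window → Set where
    unchanged    : ∀ {W} → WindowMove W W
    braid-centre : ∀ {s t f₀ f₂} → Adjacent s t →
                   WindowMove (window (side (just s) f₀) (just t) (side (just s) f₂))
                              (window (side (just t) f₀) (just s) (side (just t) f₂))
    braid-left   : ∀ {s t e R} → Adjacent s t →
                   WindowMove (window (side (just s) (just t)) e R) (window (side (just t) (just s)) e R)
    braid-right  : ∀ {s t e L} → Adjacent s t →
                   WindowMove (window L e (side (just s) (just t))) (window L e (side (just t) (just s)))

  windowAt-braid : ∀ u v {s t q m} → Adjacent s t → length u ≡ m → Proximity q m →
    WindowMove (windowAt (u ++ s ∷ t ∷ s ∷ v) q) (windowAt (u ++ t ∷ s ∷ t ∷ v) q)
  windowAt-braid u v {s} {t} st |u| (farBefore c)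
    rewrite windowAt-++ u (s ∷ t ∷ s ∷ v) (3 + c) |u|
          | windowAt-++ u (t ∷ s ∷ t ∷ v) (3 + c) |u| = unchanged
  windowAt-braid u v {s} {t} st |u| before
    rewrite windowAt-++ u (s ∷ t ∷ s ∷ v) 1 |u|
          | windowAt-++ u (t ∷ s ∷ t ∷ v) 1 |u| = braid-left st
  windowAt-braid u v {s} {t} st |u| aligned
    rewrite at-++-after u (s ∷ t ∷ s ∷ v) 0 |u| | at-++-after u (t ∷ s ∷ t ∷ v) 0 |u|
          | at-++-after u (s ∷ t ∷ s ∷ v) 1 |u| | at-++-after u (t ∷ s ∷ t ∷ v) 1 |u|
          | at-++-after u (s ∷ t ∷ s ∷ v) 2 |u| | at-++-after u (t ∷ s ∷ t ∷ v) 2 |u|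
          | at-++-after u (s ∷ t ∷ s ∷ v) 3 |u| | at-++-after u (t ∷ s ∷ t ∷ v) 3 |u|
          | at-++-before u (s ∷ t ∷ s ∷ v) (t ∷ s ∷ t ∷ v) ≤-refl |u| = braid-centre st
  windowAt-braid u v {s} {t} {q} st |u| after
    rewrite at-++-after u (s ∷ t ∷ s ∷ v) 0 |u| | at-++-after u (t ∷ s ∷ t ∷ v) 0 |u|
          | at-++-after u (s ∷ t ∷ s ∷ v) 1 |u| | at-++-after u (t ∷ s ∷ t ∷ v) 1 |u|
          | at-++-before u (s ∷ t ∷ s ∷ v) (t ∷ s ∷ t ∷ v) {p = q} (m≤n+m q 2) |u|
          | at-++-before u (s ∷ t ∷ s ∷ v) (t ∷ s ∷ t ∷ v) {p = 1 + q} (m≤n+m (1 + q) 1) |u|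
          | at-++-before u (s ∷ t ∷ s ∷ v) (t ∷ s ∷ t ∷ v) {p = 2 + q} ≤-refl |u| = braid-right st
  windowAt-braid u v {s} {t} {q} st |u| (farAfter c) =
    subst (WindowMove _) (windowAt-≡ (u ++ s ∷ t ∷ s ∷ v) (u ++ t ∷ s ∷ t ∷ v) q q agree) unchanged
    where
    agree : ∀ j → j ≤ 4 → at C (u ++ s ∷ t ∷ s ∷ v) (j + q) ≡ at C (u ++ t ∷ s ∷ t ∷ v) (j + q)
    agree j j≤4 = at-++-before u _ _ (+-mono-≤ j≤4 (m≤m+n q c)) |u|

  module _ (P : Fin n → Set) where

    SideConfined : Maybe (Fin n) → Side → Set
    SideConfined c (side o f) = ∀ {z x} → c ≡ just z → o ≡ just x →
      (Adjacent x z → P x) × (¬ Adjacent x z → ∀ {y} → f ≡ just y → Adjacent y z → P y)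

    -- Bounds the letters that can ever reach the centre of the window; triangle-freeness is what
    -- makes it survive a braid move on one side (side-swap).
    record Confined (W : Window) : Set where
      field
        centre-∈ : ∀ {z} → centre W ≡ just z → P z
        left-∈   : SideConfined (centre W) (left W)
        right-∈  : SideConfined (centre W) (right W)

    shadow-confined : ∀ {x z f₀ f₂} → Adjacent x z → P x → P z →
      Confined (window (side (just x) f₀) (just z) (side (just x) f₂))
    shadow-confined {x} {z} xz px pz =
      record { centre-∈ = λ { refl → pz } ; left-∈ = near ; right-∈ = near }
      where
      near : ∀ {f} → SideConfined (just z) (side (just x) f)
      near refl refl = (λ _ → px) , λ ¬xz → ⊥-elim (¬xz xz)

    confined-at-shadow : ∀ {w q x z} → Shadow w (1 + q) x z → P x → P z → Confined (windowAt w q)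
    confined-at-shadow (shadow hx hz hx′ xz) px pz rewrite hx | hz | hx′ = shadow-confined xz px pz

    module _ (TF : TriangleFree C) where

      side-swap : ∀ {s t e} → Adjacent s t →
        SideConfined e (side (just s) (just t)) → SideConfined e (side (just t) (just s))
      side-swap {s} {t} st conf {z} e≡z refl = near , far
        where
        near : Adjacent t z → P t
        near tz with adjacent? s z
        ... | yes sz = ⊥-elim (triangle-free TF st tz (adjacent-sym sz))
        ... | no ¬sz = proj₂ (conf e≡z refl) ¬sz refl tz
        far : ¬ Adjacent t z → ∀ {y} → just s ≡ just y → Adjacent y z → P y
        far _ refl sz = proj₁ (conf e≡z refl) sz

      confined-move : ∀ {W W′} → WindowMove W W′ → Confined W → Confined W′
      confined-move unchanged conf = conf
      confined-move (braid-centre st) conf =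
        shadow-confined (adjacent-sym st) (centre-∈ refl) (proj₁ (left-∈ refl refl) st)
        where open Confined conf
      confined-move (braid-left st) conf =
        record { centre-∈ = centre-∈ ; left-∈ = side-swap st left-∈ ; right-∈ = right-∈ }
        where open Confined conf
      confined-move (braid-right st) conf =
        record { centre-∈ = centre-∈ ; left-∈ = left-∈ ; right-∈ = side-swap st right-∈ }
        where open Confined conf

  NearRightIn : (Fin n → Set) → Window → Set
  NearRightIn P W = ∀ {p} → Side.near (right W) ≡ just p → P p

  nearRight-move : ∀ {P R : Fin n → Set} {W W′} → WindowMove W W′ → Confined P W →
    (∀ {s t} → Side.near (right W) ≡ just s → Side.far (right W) ≡ just t → Adjacent s t → R s) →
    NearRightIn P W ⊎ ∃[ s ] (P s × R s) → NearRightIn P W′ ⊎ ∃[ s ] (P s × R s)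
  nearRight-move _                  _    _      (inj₂ common) = inj₂ common
  nearRight-move unchanged          _    _      near∈P        = near∈P
  nearRight-move (braid-centre _)   conf _      _             =
    inj₁ λ { refl → Confined.centre-∈ conf refl }
  nearRight-move (braid-left _)     _    _      near∈P        = near∈P
  nearRight-move (braid-right st)   _    near∈R (inj₁ near∈P) =
    inj₂ (_ , near∈P refl , near∈R refl refl st)

  farRight-move : ∀ {W W′} → WindowMove W W′ →
    ∃[ p ] (Side.far (right W) ≡ just p) → ∃[ p ] (Side.far (right W′) ≡ just p)
  farRight-move unchanged          occupied = occupied
  farRight-move (braid-centre _)   occupied = occupied
  farRight-move (braid-left _)     occupied = occupied
  farRight-move (braid-right {s} _) _       = s , refl

  braidMove-sym : ∀ {w w′} → BraidMove C w w′ → BraidMove C w′ w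
  braidMove-sym (braid u v s t st) = braid u v t s (adjacent-sym st)

  at≡just⇒≤length : ∀ w p {s} → at C w p ≡ just s → p ≤ length w
  at≡just⇒≤length []      _             ()
  at≡just⇒≤length (_ ∷ _) zero          ()
  at≡just⇒≤length (_ ∷ _) (suc zero)    _ = s≤s z≤n
  at≡just⇒≤length (_ ∷ w) (suc (suc p)) h = s≤s (at≡just⇒≤length w (suc p) h)

  braidMove-length : ∀ {w w′} → BraidMove C w w′ → length w′ ≡ length w
  braidMove-length (braid u _ _ _ _) = trans (length-++ u) (sym (length-++ u))

  braidClass-length : ∀ {α β} → InBraidClass C α β → length β ≡ length α
  braidClass-length ε           = refl
  braidClass-length (mv ◅ path) = trans (braidClass-length path) (braidMove-length mv)

  inBS⇒≤length : ∀ {α i} → InBS C α i → i + 2 ≤ length α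
  inBS⇒≤length {i = i} (β , cβ , _ , _ , _ , hs′ , _) =
    subst (i + 2 ≤_) (braidClass-length cβ) (at≡just⇒≤length β (i + 2) hs′)

  single-letter-rank : ∀ {α r} → length α ≡ 1 → HasRank C α r → r ≡ 0
  single-letter-rank _ ([] , _ , refl , _) = refl
  single-letter-rank {α} |α|≡1 (i ∷ _ , _ , refl , spec)
    with s≤s () ← ≤-trans (m≤n+m 2 i)
                    (subst (i + 2 ≤_) |α|≡1 (inBS⇒≤length (proj₁ (spec i) (here refl))))

  rank≤ : ∀ {α r k} → HasRank C α r → (∀ i → InBS C α i → Odd C i × i + 2 ≤ 1 + 2 * k) → r ≤ k
  rank≤ {k = k} (l , l! , refl , spec) bound =
    subst (length l ≤_) (length-applyUpTo _ k) (Unique∧⊆⇒length≤ l! l⊆odds)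
    where
    l⊆odds : l ⊆ applyUpTo (λ j → 1 + 2 * j) k
    l⊆odds {i} i∈l with (j , refl) , fits ← bound i (proj₁ (spec i) i∈l) =
      ∈-applyUpTo⁺ (λ j → 1 + 2 * j) (Equivalence.to (odd-fits {j}) fits)

  UniqueCommonLetter : Word C → ℕ → ℕ → Set
  UniqueCommonLetter α p p′ = ∃[ s ] ((InSupp C α p s × InSupp C α p′ s) ×
                                     (∀ t → InSupp C α p t → InSupp C α p′ t → t ≡ s))

  module BraidClass (TF : TriangleFree C) (α : Word C)
    (shadows-odd : ∀ {w} → InBraidClass C α w → ∀ i → IsBraidShadow C w i → Odd C i) where

    transport : (P : Word C → Set) →
      (∀ {w w′} → InBraidClass C α w → BraidMove C w w′ → P w → P w′) →
      ∀ {β γ} → InBraidClass C α β → InBraidClass C α γ → P β → P γ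
    transport P step cβ cγ = along cβ (reverse braidMove-sym cβ ◅◅ cγ)
      where
      along : ∀ {w w′} → InBraidClass C α w → Star (BraidMove C) w w′ → P w → P w′
      along cw ε           = id
      along cw (mv ◅ path) = along (cw ◅◅ mv ◅ ε) path ∘ step cw mv

    prefix-even : ∀ {u v s t} → InBraidClass C α (u ++ s ∷ t ∷ s ∷ v) → Adjacent s t → Even (length u)
    prefix-even {u} {v} cw st
      with j , eq ← shadows-odd cw _ (shadow⇒isBraidShadow (braidMove-shadow u v st)) =
      subst Even (sym (suc-injective eq)) (even-double j)

    windowAt-move : ∀ {q w w′} → Even q → InBraidClass C α w → BraidMove C w w′ →
      WindowMove (windowAt w q) (windowAt w′ q)
    windowAt-move q-even cw (braid u v _ _ st) =
      windowAt-braid u v st refl (proximity q-even (prefix-even cw st))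

    no-even-shadow : ∀ {q w s t} → Even q → InBraidClass C α w → ¬ Shadow w (2 + q) s t
    no-even-shadow q-even cw sh
      with j , refl ← even⇒double q-even | j′ , eq ← shadows-odd cw _ (shadow⇒isBraidShadow sh) =
      even≢odd j′ j (sym (suc-injective eq))

    confined-transport : ∀ {q P β γ} → Even q → InBraidClass C α β → InBraidClass C α γ →
      Confined P (windowAt β q) → Confined P (windowAt γ q)
    confined-transport {q} {P} q-even =
      transport (λ w → Confined P (windowAt w q))
        λ cw mv → confined-move P TF (windowAt-move q-even cw mv)

    centre-support : ∀ {q x a β} → Even q → InBraidClass C α β → Shadow β (1 + q) x a →
      ∀ p → InSupp C α (2 + q) p ⇔ p ∈ x ∷ a ∷ []
    centre-support {q} {x} {a} {β} q-even cβ sh p = mk⇔ to from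
      where
      confined : ∀ {w} → InBraidClass C α w → Confined (_∈ x ∷ a ∷ []) (windowAt w q)
      confined cw = confined-transport q-even cβ cw (confined-at-shadow _ sh (here refl) (there (here refl)))
      to : InSupp C α (2 + q) p → p ∈ x ∷ a ∷ []
      to (_ , cw , hp) = Confined.centre-∈ (confined cw) hp
      from : p ∈ x ∷ a ∷ [] → InSupp C α (2 + q) p
      from (here refl) with β′ , mv , sh′ , _ ← braid-shadow sh = β′ , cβ ◅◅ mv ◅ ε , Shadow.middle sh′
      from (there (here refl)) = β , cβ , Shadow.middle sh

    module _ {q x a y b β γ} (q-even : Even q)
             (cβ : InBraidClass C α β) (shβ : Shadow β (1 + q) x a)
             (cγ : InBraidClass C α γ) (shγ : Shadow γ (3 + q) y b) where

      confinedβ : ∀ {w} → InBraidClass C α w → Confined (_∈ x ∷ a ∷ []) (windowAt w q)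
      confinedβ cw =
        confined-transport q-even cβ cw (confined-at-shadow _ shβ (here refl) (there (here refl)))

      confinedγ : ∀ {w} → InBraidClass C α w → Confined (_∈ y ∷ b ∷ []) (windowAt w (2 + q))
      confinedγ cw =
        confined-transport (2+ q-even) cγ cw (confined-at-shadow _ shγ (here refl) (there (here refl)))

      -- The letter at 3 + q stays in {x, a} until a braid move on the right of the window replaces
      -- it, and the letter it replaces then lies in both {x, a} and {y, b}.
      common-letter : ∃[ s ] (s ∈ x ∷ a ∷ [] × s ∈ y ∷ b ∷ [])
      common-letter = finish (transport Invariant step cβ cγ (inj₁ start))
        where
        Invariant : Word C → Set
        Invariant w =
          NearRightIn (_∈ x ∷ a ∷ []) (windowAt w q) ⊎ ∃[ s ] (s ∈ x ∷ a ∷ [] × s ∈ y ∷ b ∷ [])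
        step : ∀ {w w′} → InBraidClass C α w → BraidMove C w w′ → Invariant w → Invariant w′
        step cw mv = nearRight-move (windowAt-move q-even cw mv) (confinedβ cw)
          λ hs ht st → proj₁ (Confined.left-∈ (confinedγ cw) ht hs) st
        start : NearRightIn (_∈ x ∷ a ∷ []) (windowAt β q)
        start hp with refl ← trans (sym (Shadow.last shβ)) hp = here refl
        finish : Invariant γ → ∃[ s ] (s ∈ x ∷ a ∷ [] × s ∈ y ∷ b ∷ [])
        finish (inj₁ near∈) = y , near∈ (Shadow.first shγ) , here refl
        finish (inj₂ common) = common

      far-right-defined : ∃[ p ] (at C β (4 + q) ≡ just p)
      far-right-defined = transport (λ w → ∃[ p ] (at C w (4 + q) ≡ just p))
        (λ cw mv → farRight-move (windowAt-move q-even cw mv)) cγ cβ (b , Shadow.middle shγ)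

      -- If both lie in {y, b}, the letter at 4 + q of β is x or a, so β or its braid at 1 + q has a
      -- braid shadow at the even position 2 + q.
      not-both : x ∈ y ∷ b ∷ [] → a ∈ y ∷ b ∷ [] → ⊥
      not-both x∈ a∈ with p , hp ← far-right-defined
        with ∈-pair-exhausted (adjacent⇒≢ (Shadow.adjacent shβ)) x∈ a∈ (Confined.centre-∈ (confinedγ cβ) hp)
      ... | inj₂ refl = no-even-shadow q-even cβ (shadow-next shβ hp)
      ... | inj₁ refl with β′ , mv , shβ′ , same ← braid-shadow shβ =
        no-even-shadow q-even (cβ ◅◅ mv ◅ ε) (shadow-next shβ′ (trans same hp))

      unique-common-letter : UniqueCommonLetter α (2 + q) (4 + q)
      unique-common-letter with s , s∈β , s∈γ ← common-letter =
        s , (from (supportβ s) s∈β , from (supportγ s) s∈γ) ,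
        λ t t∈β t∈γ → ∈-pair-unique not-both s∈β s∈γ (to (supportβ t) t∈β) (to (supportγ t) t∈γ)
        where
        open Equivalence
        supportβ : ∀ p → InSupp C α (2 + q) p ⇔ p ∈ x ∷ a ∷ []
        supportβ = centre-support q-even cβ shβ
        supportγ : ∀ p → InSupp C α (4 + q) p ⇔ p ∈ y ∷ b ∷ []
        supportγ = centre-support (2+ q-even) cγ shγ

    unique-common-letter-between : ∀ {q} → Even q → InBS C α (1 + q) → InBS C α (3 + q) →
      UniqueCommonLetter α (2 + q) (4 + q)
    unique-common-letter-between q-even (_ , cβ , bsβ) (_ , cγ , bsγ)
      with _ , _ , shβ ← isBraidShadow⇒shadow bsβ | _ , _ , shγ ← isBraidShadow⇒shadow bsγ =
      unique-common-letter q-even cβ shβ cγ shγ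

corollary3p16 : ∀ {n} (C : CoxeterSystem n) → SimplyLaced C → TriangleFree C →
    ∀ (α : Word C) (r : ℕ) → IsLink C α → HasRank C α r → 2 ≤ r →
    ∀ i → 1 ≤ i → i ≤ r ∸ 1 →
    ∃[ s ] ((InSupp C α (2 * i) s × InSupp C α (2 * i + 2) s) ×
            (∀ t → InSupp C α (2 * i) t → InSupp C α (2 * i + 2) t → t ≡ s))
corollary3p16 C _ TF α r (_ , _ , inj₁ |α|≡1) rank 2≤r _ _ _
  with refl ← single-letter-rank C |α|≡1 rank with () ← 2≤r
corollary3p16 C _ TF α (suc r) (_ , _ , inj₂ ((k , |α|) , shadows)) rank (s≤s _) (suc a) _ i≤r-1 =
  subst₂ (UniqueCommonLetter C α) centre≡ next≡
    (unique-common-letter-between (even-double a) (shadow-at (<⇒≤ i<k))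
      (subst (InBS C α) (cong suc (*-suc 2 a)) (shadow-at i<k)))
  where
  open BraidClass C TF α (λ cw i sh → proj₁ (proj₁ (shadows i) (_ , cw , sh)))
  i<k : suc a < k
  i<k = ≤-trans (s≤s i≤r-1)
          (rank≤ C rank λ i sh → map₂ (subst (i + 2 ≤_) |α|) (proj₁ (shadows i) sh))
  shadow-at : ∀ {j} → j < k → InBS C α (1 + 2 * j)
  shadow-at {j} j<k =
    proj₂ (shadows _) ((j , refl) , subst ((1 + 2 * j) + 2 ≤_) (sym |α|) (Equivalence.from odd-fits j<k))
  centre≡ : 2 + 2 * a ≡ 2 * suc a
  centre≡ = sym (*-suc 2 a)
  next≡ : 4 + 2 * a ≡ 2 * suc a + 2
  next≡ = trans (cong (2 +_) centre≡) (+-comm 2 (2 * suc a))
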